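{- Let $\lambda$ be a nonzero real number. For all integers $n,r\ge0$ and every $x$, $$ \sum_{k=0}^{n}(k)_{r,\lambda}x^{k}=\sum_{j=0}^{r}j!{r \brace j}_{\lambda}\sum_{k=0}^{n}\binom{k}{j}x^{k}. $$ In particular, $$ \sum_{k=0}^{n}(k)_{r,\lambda}=\sum_{j=0}^{r}j!\binom{n+1}{j+1}{r \brace j}_{\lambda}. $$
   Context: For a real parameter $\mu$ the degenerate falling factorials are $(x)_{0,\mu}=1$ and $(x)_{n,\mu}=x(x-\mu)\cdots(x-(n-1)\mu)$ for $n\ge1$; $(x)_n=(x)_{n,1}$ is the usual falling factorial and $\binom{y}{m}=(y)_m/m!$. The degenerate Stirling numbers of the second kind ${n \brace k}_{\mu}$ are defined by $(x)_{n,\mu}=\sum_{k=0}^{n}{n \brace k}_{\mu}(x)_k$. -}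

module Defs where

open import Level using (Level)
open import Data.Nat as ℕ using (ℕ; zero; suc)
open import Data.Nat.Combinatorics using (_C_)
open import Data.Nat using (_!)
open import Algebra.Bundles using (CommutativeRing)

-- All notions are defined over an arbitrary commutative ring R
-- (standing in for ℝ, which agda-stdlib lacks).
module _ {c ℓ : Level} (R : CommutativeRing c ℓ) where
  open CommutativeRing R

  ι : ℕ → Carrier
  ι zero    = 0#
  ι (suc n) = 1# + ι n

  pow : Carrier → ℕ → Carrier
  pow x zero    = 1#
  pow x (suc n) = pow x n * x

  dff : Carrier → ℕ → Carrier → Carrier
  dff x zero    μ = 1#
  dff x (suc n) μ = dff x n μ * (x - ι n * μ)

  ff : Carrier → ℕ → Carrier
  ff x n = dff x n 1#

  sumTo : ℕ → (ℕ → Carrier) → Carrier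
  sumTo zero    f = f 0
  sumTo (suc n) f = sumTo n f + f (suc n)

  IsDegStirling2 : Carrier → (ℕ → ℕ → Carrier) → Set (c Level.⊔ ℓ)
  IsDegStirling2 μ S = ∀ (n : ℕ) (x : Carrier) → dff x n μ ≈ sumTo n (λ k → S n k * ff x k)

module Submission where

-- Expanding (k)_{r,λ} in the basis of falling factorials and evaluating
-- (k)_j = j! C(k,j) at natural k turns the left-hand side into a double sum;
-- exchanging the two sums gives the first identity, and the hockey-stick
-- identity Σ_{k≤n} C(k,j) = C(n+1,j+1) then gives the second.  The evaluation
-- (k)_j = j! C(k,j) follows by induction from the Pascal recurrence
-- (y+μ)_{j+1,μ} = (y)_{j+1,μ} + (j+1)μ (y)_{j,μ}.

open import Defs
open import Level using (Level)
open import Data.Nat using (ℕ; zero; suc; _!)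
import Data.Nat as ℕ
open import Data.Nat.Combinatorics using (_C_; nCk+nC[k+1]≡[n+1]C[k+1])
open import Data.Product using (_×_; _,_)
open import Relation.Nullary using (¬_)
open import Relation.Binary.PropositionalEquality using (cong)
open import Algebra.Bundles using (CommutativeRing)
import Algebra.Properties.Ring as RingProperties
import Algebra.Properties.CommutativeSemigroup as CommutativeSemigroupProperties
import Relation.Binary.Reasoning.Setoid as SetoidReasoning

module _ {c ℓ : Level} (R : CommutativeRing c ℓ) where
  open CommutativeRing R
  open RingProperties ring using (-0#≈0#; -‿+-comm)
  open CommutativeSemigroupProperties +-commutativeSemigroup
    using () renaming (interchange to +-interchange)
  open CommutativeSemigroupProperties *-commutativeSemigroup
    using (xy∙z≈xz∙y)
  open SetoidReasoning setoid

  [x+y]-[x+z]≈y-z : ∀ x y z → (x + y) - (x + z) ≈ y - z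
  [x+y]-[x+z]≈y-z x y z = begin
    (x + y) + - (x + z)   ≈⟨ +-congˡ (-‿+-comm x z) ⟨
    (x + y) + (- x + - z) ≈⟨ +-interchange x y (- x) (- z) ⟩
    (x - x) + (y - z)     ≈⟨ +-congʳ (-‿inverseʳ x) ⟩
    0# + (y - z)          ≈⟨ +-identityˡ (y - z) ⟩
    y - z                 ∎

  [y-z]+[x+z]≈x+y : ∀ x y z → (y - z) + (x + z) ≈ x + y
  [y-z]+[x+z]≈x+y x y z = begin
    (y + - z) + (x + z) ≈⟨ +-interchange y (- z) x z ⟩
    (y + x) + (- z + z) ≈⟨ +-congˡ (-‿inverseˡ z) ⟩
    (y + x) + 0#        ≈⟨ +-identityʳ (y + x) ⟩
    y + x               ≈⟨ +-comm y x ⟩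
    x + y               ∎

  ι-+ : ∀ m n → ι R (m ℕ.+ n) ≈ ι R m + ι R n
  ι-+ zero    n = sym (+-identityˡ (ι R n))
  ι-+ (suc m) n = trans (+-congˡ (ι-+ m n)) (sym (+-assoc 1# (ι R m) (ι R n)))

  ι-suc-* : ∀ n x → ι R (suc n) * x ≈ x + ι R n * x
  ι-suc-* n x = trans (distribʳ x 1# (ι R n)) (+-congʳ (*-identityˡ x))

  ι-* : ∀ m n → ι R (m ℕ.* n) ≈ ι R m * ι R n
  ι-* zero    n = sym (zeroˡ (ι R n))
  ι-* (suc m) n = begin
    ι R (n ℕ.+ m ℕ.* n)       ≈⟨ ι-+ n (m ℕ.* n) ⟩
    ι R n + ι R (m ℕ.* n)     ≈⟨ +-congˡ (ι-* m n) ⟩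
    ι R n + ι R m * ι R n     ≈⟨ ι-suc-* m (ι R n) ⟨
    ι R (suc m) * ι R n       ∎

  ι-pascal : ∀ n k → ι R (n C k) + ι R (n C suc k) ≈ ι R (suc n C suc k)
  ι-pascal n k = trans (sym (ι-+ (n C k) (n C suc k)))
                       (reflexive (cong (ι R) (nCk+nC[k+1]≡[n+1]C[k+1] n k)))

  hockey-stick : ∀ n j → sumTo R n (λ k → ι R (k C j)) ≈ ι R (suc n C suc j)
  hockey-stick zero    j = trans (sym (+-identityʳ (ι R (0 C j)))) (ι-pascal 0 j)
  hockey-stick (suc n) j = begin
    sumTo R n (λ k → ι R (k C j)) + ι R (suc n C j) ≈⟨ +-congʳ (hockey-stick n j) ⟩
    ι R (suc n C suc j) + ι R (suc n C j)           ≈⟨ +-comm _ _ ⟩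
    ι R (suc n C j) + ι R (suc n C suc j)           ≈⟨ ι-pascal (suc n) j ⟩
    ι R (suc (suc n) C suc j)                       ∎

  sumTo-cong : ∀ n {f g : ℕ → Carrier} → (∀ k → f k ≈ g k) → sumTo R n f ≈ sumTo R n g
  sumTo-cong zero    f≈g = f≈g 0
  sumTo-cong (suc n) f≈g = +-cong (sumTo-cong n f≈g) (f≈g (suc n))

  sumTo-distrib-+ : ∀ n (f g : ℕ → Carrier) →
                    sumTo R n (λ k → f k + g k) ≈ sumTo R n f + sumTo R n g
  sumTo-distrib-+ zero    f g = refl
  sumTo-distrib-+ (suc n) f g =
    trans (+-congʳ (sumTo-distrib-+ n f g)) (+-interchange _ _ _ _)

  *-distribˡ-sumTo : ∀ n a (f : ℕ → Carrier) → a * sumTo R n f ≈ sumTo R n (λ k → a * f k)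
  *-distribˡ-sumTo zero    a f = refl
  *-distribˡ-sumTo (suc n) a f = trans (distribˡ a _ _) (+-congʳ (*-distribˡ-sumTo n a f))

  *-distribʳ-sumTo : ∀ n a (f : ℕ → Carrier) → sumTo R n f * a ≈ sumTo R n (λ k → f k * a)
  *-distribʳ-sumTo zero    a f = refl
  *-distribʳ-sumTo (suc n) a f = trans (distribʳ a _ _) (+-congʳ (*-distribʳ-sumTo n a f))

  sumTo-comm : ∀ n m (F : ℕ → ℕ → Carrier) →
               sumTo R n (λ k → sumTo R m (F k)) ≈ sumTo R m (λ j → sumTo R n (λ k → F k j))
  sumTo-comm zero    m F = refl
  sumTo-comm (suc n) m F = begin
    sumTo R n (λ k → sumTo R m (F k)) + sumTo R m (F (suc n))
      ≈⟨ +-congʳ (sumTo-comm n m F) ⟩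
    sumTo R m (λ j → sumTo R n (λ k → F k j)) + sumTo R m (F (suc n))
      ≈⟨ sumTo-distrib-+ m _ _ ⟨
    sumTo R m (λ j → sumTo R n (λ k → F k j) + F (suc n) j) ∎

  dff-one : ∀ x μ → dff R x 1 μ ≈ x
  dff-one x μ = begin
    1# * (x - 0# * μ) ≈⟨ *-identityˡ _ ⟩
    x - 0# * μ        ≈⟨ +-congˡ (trans (-‿cong (zeroˡ μ)) -0#≈0#) ⟩
    x + 0#            ≈⟨ +-identityʳ x ⟩
    x                 ∎

  dff-zeroˡ : ∀ j μ → dff R 0# (suc j) μ ≈ 0#
  dff-zeroˡ zero    μ = dff-one 0# μ
  dff-zeroˡ (suc j) μ = trans (*-congʳ (dff-zeroˡ j μ)) (zeroˡ _)

  dff-+μ : ∀ μ y j → dff R (μ + y) (suc j) μ ≈ (μ + y) * dff R y j μ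
  dff-+μ μ y zero    = trans (dff-one (μ + y) μ) (sym (*-identityʳ (μ + y)))
  dff-+μ μ y (suc j) = begin
    dff R (μ + y) (suc j) μ * ((μ + y) - ι R (suc j) * μ)
      ≈⟨ *-cong (dff-+μ μ y j) (+-congˡ (-‿cong (ι-suc-* j μ))) ⟩
    (μ + y) * dff R y j μ * ((μ + y) - (μ + ι R j * μ))
      ≈⟨ *-congˡ ([x+y]-[x+z]≈y-z μ y (ι R j * μ)) ⟩
    (μ + y) * dff R y j μ * (y - ι R j * μ)
      ≈⟨ *-assoc _ _ _ ⟩
    (μ + y) * dff R y (suc j) μ ∎

  dff-pascal : ∀ μ y j →
    dff R (μ + y) (suc j) μ ≈ dff R y (suc j) μ + ι R (suc j) * μ * dff R y j μ
  dff-pascal μ y j = begin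
    dff R (μ + y) (suc j) μ
      ≈⟨ dff-+μ μ y j ⟩
    (μ + y) * a
      ≈⟨ *-congʳ ([y-z]+[x+z]≈x+y μ y (ι R j * μ)) ⟨
    ((y - ι R j * μ) + (μ + ι R j * μ)) * a
      ≈⟨ distribʳ a _ _ ⟩
    (y - ι R j * μ) * a + (μ + ι R j * μ) * a
      ≈⟨ +-cong (*-comm _ a) (*-congʳ (sym (ι-suc-* j μ))) ⟩
    a * (y - ι R j * μ) + ι R (suc j) * μ * a ∎
    where a = dff R y j μ

  ff-ι : ∀ k j → ff R (ι R k) j ≈ ι R (j !) * ι R (k C j)
  ff-ι k       zero    = sym (trans (*-cong (+-identityʳ 1#) (+-identityʳ 1#)) (*-identityˡ 1#))
  ff-ι zero    (suc j) = trans (dff-zeroˡ j 1#) (sym (zeroʳ _))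
  ff-ι (suc k) (suc j) = begin
    ff R (1# + ι R k) (suc j)
      ≈⟨ dff-pascal 1# (ι R k) j ⟩
    ff R (ι R k) (suc j) + ι R (suc j) * 1# * ff R (ι R k) j
      ≈⟨ +-cong (ff-ι k (suc j)) (*-congˡ (ff-ι k j)) ⟩
    ι R (suc j !) * ι R (k C suc j) + ι R (suc j) * 1# * (ι R (j !) * ι R (k C j))
      ≈⟨ +-congˡ lower-term ⟩
    ι R (suc j !) * ι R (k C suc j) + ι R (suc j !) * ι R (k C j)
      ≈⟨ trans (+-comm _ _) (sym (distribˡ _ _ _)) ⟩
    ι R (suc j !) * (ι R (k C j) + ι R (k C suc j))
      ≈⟨ *-congˡ (ι-pascal k j) ⟩
    ι R (suc j !) * ι R (suc k C suc j) ∎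
    where
    lower-term : ι R (suc j) * 1# * (ι R (j !) * ι R (k C j)) ≈ ι R (suc j !) * ι R (k C j)
    lower-term = begin
      ι R (suc j) * 1# * (ι R (j !) * ι R (k C j)) ≈⟨ *-congʳ (*-identityʳ _) ⟩
      ι R (suc j) * (ι R (j !) * ι R (k C j))      ≈⟨ *-assoc _ _ _ ⟨
      ι R (suc j) * ι R (j !) * ι R (k C j)        ≈⟨ *-congʳ (ι-* (suc j) (j !)) ⟨
      ι R (suc j !) * ι R (k C j)                  ∎

  module _ {μ : Carrier} {S : ℕ → ℕ → Carrier} (S-stirling : IsDegStirling2 R μ S) where

    dff-ι-expansion : ∀ r k →
      dff R (ι R k) r μ ≈ sumTo R r (λ j → ι R (j !) * S r j * ι R (k C j))
    dff-ι-expansion r k = trans (S-stirling r (ι R k)) (sumTo-cong r λ j → begin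
      S r j * ff R (ι R k) j           ≈⟨ *-congˡ (ff-ι k j) ⟩
      S r j * (ι R (j !) * ι R (k C j)) ≈⟨ *-assoc _ _ _ ⟨
      S r j * ι R (j !) * ι R (k C j)   ≈⟨ *-congʳ (*-comm _ _) ⟩
      ι R (j !) * S r j * ι R (k C j)   ∎)

    weighted-sumTo-dff-ι : ∀ n r (w : ℕ → Carrier) →
      sumTo R n (λ k → dff R (ι R k) r μ * w k)
        ≈ sumTo R r (λ j → ι R (j !) * S r j * sumTo R n (λ k → ι R (k C j) * w k))
    weighted-sumTo-dff-ι n r w = begin
      sumTo R n (λ k → dff R (ι R k) r μ * w k)
        ≈⟨ sumTo-cong n (λ k → trans (*-congʳ (dff-ι-expansion r k)) (*-distribʳ-sumTo r (w k) _)) ⟩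
      sumTo R n (λ k → sumTo R r (λ j → ι R (j !) * S r j * ι R (k C j) * w k))
        ≈⟨ sumTo-comm n r _ ⟩
      sumTo R r (λ j → sumTo R n (λ k → ι R (j !) * S r j * ι R (k C j) * w k))
        ≈⟨ sumTo-cong r (λ j → trans (sumTo-cong n (λ k → *-assoc _ _ _))
                                     (sym (*-distribˡ-sumTo n _ _))) ⟩
      sumTo R r (λ j → ι R (j !) * S r j * sumTo R n (λ k → ι R (k C j) * w k)) ∎

    sumTo-dff-ι : ∀ n r →
      sumTo R n (λ k → dff R (ι R k) r μ)
        ≈ sumTo R r (λ j → ι R (j !) * ι R (suc n C suc j) * S r j)
    sumTo-dff-ι n r = begin
      sumTo R n (λ k → dff R (ι R k) r μ)
        ≈⟨ sumTo-cong n (λ _ → *-identityʳ _) ⟨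
      sumTo R n (λ k → dff R (ι R k) r μ * 1#)
        ≈⟨ weighted-sumTo-dff-ι n r (λ _ → 1#) ⟩
      sumTo R r (λ j → ι R (j !) * S r j * sumTo R n (λ k → ι R (k C j) * 1#))
        ≈⟨ sumTo-cong r (λ j → *-congˡ (trans (sumTo-cong n (λ _ → *-identityʳ _))
                                              (hockey-stick n j))) ⟩
      sumTo R r (λ j → ι R (j !) * S r j * ι R (suc n C suc j))
        ≈⟨ sumTo-cong r (λ j → xy∙z≈xz∙y _ _ _) ⟩
      sumTo R r (λ j → ι R (j !) * ι R (suc n C suc j) * S r j) ∎

theorem2p15 : ∀ {c ℓ : Level} (R : CommutativeRing c ℓ) →
    let open CommutativeRing R in
    (lam : Carrier) → ¬ (lam ≈ 0#) →
    (S : ℕ → ℕ → Carrier) → IsDegStirling2 R lam S →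
    (n r : ℕ) (x : Carrier) →
      (sumTo R n (λ k → dff R (ι R k) r lam * pow R x k)
        ≈ sumTo R r (λ j → ι R (j !) * S r j * sumTo R n (λ k → ι R (k C j) * pow R x k)))
      × (sumTo R n (λ k → dff R (ι R k) r lam)
        ≈ sumTo R r (λ j → ι R (j !) * ι R (suc n C suc j) * S r j))
theorem2p15 R _ _ _ S-stirling n r x =
  weighted-sumTo-dff-ι R S-stirling n r (pow R x) , sumTo-dff-ι R S-stirling n r
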